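{- Let $k_A,k_B,\Delta_A,\Delta_B$ be positive integers with $\Delta_A \geq k_A$, $\Delta_B \geq k_B$, and $\Delta_B (\log \Delta_A)^{k_A-1} > 2^{2k_A-1} (\log k_A)^{k_A-1} k_B^{k_A}$. Then $K_{\Delta_B,\Delta_A}$ is not $(k_A,k_B)$-choosable.
   Context: All graphs are finite and simple. For a bipartite graph $G$ with bipartition $V = A \sqcup B$ and positive integers $k_A, k_B$, $G$ is $(k_A,k_B)$-choosable if for every set of colors $C$ and every list assignment $L$ assigning to each vertex of $A$ a $k_A$-element subset of $C$ and to each vertex of $B$ a $k_B$-element subset of $C$, there is a map $c\colon V\to C$ with $c(v)\in L(v)$ for all $v$ and $c(v)\neq c(v')$ for every edge $vv'$. For the complete bipartite graph $K_{\Delta_B,\Delta_A}$ the part $A$ has $\Delta_B$ vertices and the part $B$ has $\Delta_A$ vertices. $\log$ is the natural logarithm, with the convention $(\log x)^0=1$. -}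

module Defs where

open import Data.Nat using (ℕ; zero; suc; _+_; _*_; _∸_; _^_; _<_; _≤_)
open import Data.Fin using (Fin)
open import Data.List using (List; length)
open import Data.List.Membership.Propositional using (_∈_)
open import Data.List.Relation.Unary.Unique.Propositional using (Unique)
open import Data.Product using (Σ; _×_; ∃-syntax)
open import Data.Unit using (⊤)
open import Data.Empty using (⊥)
open import Relation.Binary.PropositionalEquality using (_≡_; _≢_)

IsKSubset : {C : Set} → ℕ → List C → Set
IsKSubset k l = length l ≡ k × Unique l

-- A bipartite graph with parts A = Fin nA, B = Fin nB and edge relation E
-- (edges only go between A and B).
-- (kA,kB)-choosability: for every colour set C and every list assignment
-- giving kA-subsets on A and kB-subsets on B, there is a proper colouring
-- from the lists.
Choosable : (nA nB : ℕ) (E : Fin nA → Fin nB → Set) (kA kB : ℕ) → Set₁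
Choosable nA nB E kA kB =
  (C : Set) (LA : Fin nA → List C) (LB : Fin nB → List C) →
  (∀ v → IsKSubset kA (LA v)) → (∀ w → IsKSubset kB (LB w)) →
  Σ (Fin nA → C) λ cA → Σ (Fin nB → C) λ cB →
    (∀ v → cA v ∈ LA v) × (∀ w → cB w ∈ LB w) ×
    (∀ v w → E v w → cA v ≢ cB w)

-- Complete bipartite graph K_{ΔB,ΔA}: part A has ΔB vertices, part B has ΔA
-- vertices, every A–B pair is an edge.
KEdge : (ΔB ΔA : ℕ) → Fin ΔB → Fin ΔA → Set
KEdge _ _ _ _ = ⊤

-- The real inequality
--   ΔB (log ΔA)^(kA-1) > 2^(2kA-1) (log kA)^(kA-1) kB^kA
-- expressed exactly in integer arithmetic (no reals in agda-stdlib).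
-- kA = 1: both log factors are (log x)^0 = 1, so it reads ΔB > 2^1 * kB^1.
-- kA = m+2 (so log kA > 0): with K = 2^(2kA-1) kB^kA the inequality is
--   (log ΔA / log kA)^(m+1) > K / ΔB,
-- which holds iff there is a rational a/b (b > 0) with
--   a/b < log ΔA / log kA   (i.e. kA^a < ΔA^b)   and   (a/b)^(m+1) > K/ΔB.
LogCond : (kA kB ΔA ΔB : ℕ) → Set
LogCond zero kB ΔA ΔB = ⊥  -- excluded by kA ≥ 1
LogCond (suc zero) kB ΔA ΔB = 2 ^ 1 * kB ^ 1 < ΔB
LogCond (suc (suc m)) kB ΔA ΔB =
  ∃[ a ] ∃[ b ] (0 < b ×
    (suc (suc m)) ^ a < ΔA ^ b ×
    2 ^ (2 * suc (suc m) ∸ 1) * kB ^ (suc (suc m)) * b ^ (suc m)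
      < ΔB * a ^ (suc m))

{-# OPTIONS --safe #-}

-- The colours are the cells (i , l , j) of L blocks, each a kA × g grid.
-- A vertex on the ΔB side is a block l with one cell in every row of l; a
-- vertex on the ΔA side chooses a row ρ l in every block l and gets all
-- cells of these rows.  If the ΔB side is coloured from its lists, every
-- block has a row all of whose cells are used, for otherwise the vertex
-- choosing an unused cell in each row of that block is not coloured; the
-- ΔA-side vertex choosing these rows then has only used colours.
-- Non-choosability passes to larger complete bipartite graphs and shorter
-- lists, so it suffices that kA ^ L ≤ ΔA, L * g ^ kA ≤ ΔB and kB ≤ L * g.
-- Take L = ⌊a / b⌋, clamped to 1 ≤ L ≤ kB, for the rational
-- a / b < log ΔA / log kA of the hypothesis, and g about kB / L.  Then
-- L * g ≤ 2 * kB and a ≤ 2 * L * b, and the logarithmic hypothesis gives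
-- L * g ^ kA ≤ ΔB.

module Submission where

open import Defs
open import Algebra.Properties.CommutativeSemigroup using (interchange)
open import Data.Empty using (⊥-elim)
open import Data.Fin using (Fin; toℕ; inject≤; combine; remQuot; finToFun; funToFin; _≟_)
open import Data.Fin.Properties
  using (toℕ-injective; toℕ-fromℕ<; toℕ-inject≤; toℕ<n; remQuot-combine; combine-remQuot;
         finToFun-funToFin; any?; all?; ¬∀⟶∃¬)
open import Data.List using (List; take; tabulate)
open import Data.List.Properties using (length-take; length-tabulate)
open import Data.List.Membership.Propositional using (_∈_)
open import Data.List.Membership.Propositional.Properties using (∈-tabulate⁻)
open import Data.List.Relation.Binary.Sublist.Propositional using (lookup)
open import Data.List.Relation.Binary.Sublist.Propositional.Properties using (take-⊆)
import Data.List.Relation.Unary.Unique.Propositional.Properties as Unique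
open import Data.Nat hiding (_≟_)
open import Data.Nat.DivMod
open import Data.Nat.Properties hiding (_≟_)
open import Data.Nat.Tactic.RingSolver using (solve-∀)
open import Data.Product using (∃; _×_; _,_; proj₁; proj₂; uncurry)
open import Data.Product.Properties using (≡-dec)
open import Data.Unit using (tt)
open import Function using (_∘_)
open import Relation.Binary.PropositionalEquality
open import Relation.Nullary using (¬_; yes; no)
open import Relation.Unary using (Decidable)

IsKSubset-take : ∀ {C : Set} {k k′} {xs : List C} → k ≤ k′ → IsKSubset k′ xs → IsKSubset k (take k xs)
IsKSubset-take {k = k} {xs = xs} k≤k′ (length≡k′ , unique) =
  trans (length-take k xs) (trans (cong (k ⊓_) length≡k′) (m≤n⇒m⊓n≡m k≤k′)) ,
  Unique.take⁺ k unique

Choosable-mono-kB : ∀ {nA nB E kA kB kB′} → kB ≤ kB′ → Choosable nA nB E kA kB → Choosable nA nB E kA kB′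
Choosable-mono-kB {kB = kB} kB≤kB′ choosable C LA LB sizeA sizeB =
  let cA , cB , cA∈ , cB∈ , proper = choosable C LA (take kB ∘ LB) sizeA (IsKSubset-take kB≤kB′ ∘ sizeB)
  in  cA , cB , cA∈ , (λ w → lookup (take-⊆ kB (LB w)) (cB∈ w)) , proper

Choosable-retract : ∀ {nA nA′ nB nB′ E kA kB}
  (sA : Fin nA → Fin nA′) (rA : Fin nA′ → Fin nA) → (∀ v → rA (sA v) ≡ v) →
  (sB : Fin nB → Fin nB′) (rB : Fin nB′ → Fin nB) → (∀ w → rB (sB w) ≡ w) →
  Choosable nA′ nB′ E kA kB → Choosable nA nB (λ v w → E (sA v) (sB w)) kA kB
Choosable-retract sA rA rA∘sA sB rB rB∘sB choosable C LA LB sizeA sizeB =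
  let cA , cB , cA∈ , cB∈ , proper = choosable C (LA ∘ rA) (LB ∘ rB) (sizeA ∘ rA) (sizeB ∘ rB)
  in  cA ∘ sA , cB ∘ sB ,
      (λ v → subst (λ u → cA (sA v) ∈ LA u) (rA∘sA v) (cA∈ (sA v))) ,
      (λ w → subst (λ u → cB (sB w) ∈ LB u) (rB∘sB w) (cB∈ (sB w))) ,
      (λ v w → proper (sA v) (sB w))

mod-inject≤ : ∀ {m n} .{{_ : NonZero m}} (i : Fin m) (m≤n : m ≤ n) → toℕ (inject≤ i m≤n) mod m ≡ i
mod-inject≤ {m} i m≤n = toℕ-injective (begin
  toℕ (toℕ (inject≤ i m≤n) mod m)  ≡⟨ toℕ-fromℕ< _ ⟩
  toℕ (inject≤ i m≤n) % m          ≡⟨ cong (_% m) (toℕ-inject≤ i m≤n) ⟩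
  toℕ i % m                        ≡⟨ m<n⇒m%n≡m (toℕ<n i) ⟩
  toℕ i                            ∎)
  where open ≡-Reasoning

Choosable-K-antimono : ∀ {nA nA′ nB nB′ kA kB} .{{_ : NonZero nA}} .{{_ : NonZero nB}} →
  nA ≤ nA′ → nB ≤ nB′ →
  Choosable nA′ nB′ (KEdge nA′ nB′) kA kB → Choosable nA nB (KEdge nA nB) kA kB
Choosable-K-antimono {nA} {nB = nB} nA≤nA′ nB≤nB′ =
  Choosable-retract (λ v → inject≤ v nA≤nA′) (λ v → toℕ v mod nA) (λ v → mod-inject≤ v nA≤nA′)
                    (λ w → inject≤ w nB≤nB′) (λ w → toℕ w mod nB) (λ w → mod-inject≤ w nB≤nB′)

module Blocks (k L g : ℕ) where

  Colour : Set
  Colour = Fin k × Fin L × Fin g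

  block : Fin (L * g ^ k) → Fin L
  block v = proj₁ (remQuot {L} (g ^ k) v)

  pick : Fin (L * g ^ k) → Fin k → Fin g
  pick v = finToFun (proj₂ (remQuot {L} (g ^ k) v))

  vertexA : Fin L → (Fin k → Fin g) → Fin (L * g ^ k)
  vertexA l φ = combine l (funToFin φ)

  block-vertexA : ∀ l φ → block (vertexA l φ) ≡ l
  block-vertexA l φ = cong proj₁ (remQuot-combine l (funToFin φ))

  pick-vertexA : ∀ l φ i → pick (vertexA l φ) i ≡ φ i
  pick-vertexA l φ i =
    trans (cong (λ p → finToFun (proj₂ p) i) (remQuot-combine l (funToFin φ))) (finToFun-funToFin φ i)

  listA : Fin (L * g ^ k) → List Colour
  listA v = tabulate λ i → i , block v , pick v i

  row : Fin (k ^ L) → Fin L → Fin k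
  row = finToFun

  cell : Fin (L * g) → Fin L × Fin g
  cell = remQuot {L} g

  cell-injective : ∀ {t t′} → cell t ≡ cell t′ → t ≡ t′
  cell-injective {t} {t′} eq =
    trans (sym (combine-remQuot {L} g t)) (trans (cong (uncurry combine) eq) (combine-remQuot {L} g t′))

  listB : Fin (k ^ L) → List Colour
  listB w = tabulate λ t → row w (proj₁ (cell t)) , cell t

  listA-IsKSubset : ∀ v → IsKSubset k (listA v)
  listA-IsKSubset v = length-tabulate _ , Unique.tabulate⁺ (cong proj₁)

  listB-IsKSubset : ∀ w → IsKSubset (L * g) (listB w)
  listB-IsKSubset w = length-tabulate _ , Unique.tabulate⁺ (cell-injective ∘ cong proj₂)

  module _ (cA : Fin (L * g ^ k) → Colour) (cA∈ : ∀ v → cA v ∈ listA v) where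

    Used : Colour → Set
    Used c = ∃ λ v → cA v ≡ c

    used? : Decidable Used
    used? c = any? (λ v → ≡-dec _≟_ (≡-dec _≟_ _≟_) (cA v) c)

    full-row : ∀ l → ∃ λ i → ∀ j → Used (i , l , j)
    full-row l with any? (λ i → all? (λ j → used? (i , l , j)))
    ... | yes full = full
    ... | no ¬full = ⊥-elim (missed i (vertexA l φ , cA-vertexA))
      where
      unused-cell : ∀ i → ∃ λ j → ¬ Used (i , l , j)
      unused-cell i = ¬∀⟶∃¬ g _ (λ j → used? (i , l , j)) (λ all-used → ¬full (i , all-used))
      φ : Fin k → Fin g
      φ i = proj₁ (unused-cell i)
      missed : ∀ i → ¬ Used (i , l , φ i)
      missed i = proj₂ (unused-cell i)
      i : Fin k
      i = proj₁ (∈-tabulate⁻ (cA∈ (vertexA l φ)))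
      cA-vertexA : cA (vertexA l φ) ≡ (i , l , φ i)
      cA-vertexA = trans (proj₂ (∈-tabulate⁻ (cA∈ (vertexA l φ))))
                         (cong₂ (λ l′ j → i , l′ , j) (block-vertexA l φ) (pick-vertexA l φ i))

  ¬Choosable : ¬ Choosable (L * g ^ k) (k ^ L) (KEdge (L * g ^ k) (k ^ L)) k (L * g)
  ¬Choosable choosable with choosable Colour listA listB listA-IsKSubset listB-IsKSubset
  ... | cA , cB , cA∈ , cB∈ , proper = proper v w tt (trans cAv≡ (sym cBw≡))
    where
    ρ : Fin L → Fin k
    ρ l = proj₁ (full-row cA cA∈ l)
    w = funToFin ρ
    t = proj₁ (∈-tabulate⁻ (cB∈ w))
    l = proj₁ (cell t)
    j = proj₂ (cell t)
    cBw≡ : cB w ≡ (ρ l , l , j)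
    cBw≡ = trans (proj₂ (∈-tabulate⁻ (cB∈ w))) (cong (_, cell t) (finToFun-funToFin ρ l))
    v = proj₁ (proj₂ (full-row cA cA∈ l) j)
    cAv≡ = proj₂ (proj₂ (full-row cA cA∈ l) j)

m<[1+m/n]*n : ∀ m n .{{_ : NonZero n}} → m < suc (m / n) * n
m<[1+m/n]*n m n = begin-strict
  m                  ≡⟨ m≡m%n+[m/n]*n m n ⟩
  m % n + m / n * n  <⟨ +-monoˡ-< (m / n * n) (m%n<n m n) ⟩
  n + m / n * n      ∎
  where open ≤-Reasoning

m≤2*[m/n]*n : ∀ m n .{{_ : NonZero n}} → n ≤ m → m ≤ 2 * (m / n) * n
m≤2*[m/n]*n m n n≤m = begin
  m                  ≤⟨ <⇒≤ (m<[1+m/n]*n m n) ⟩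
  suc (m / n) * n    ≤⟨ *-monoˡ-≤ n 1+m/n≤2*[m/n] ⟩
  2 * (m / n) * n    ∎
  where
  open ≤-Reasoning
  instance
    m/n≢0 : NonZero (m / n)
    m/n≢0 = >-nonZero (m≥n⇒m/n>0 n≤m)
  1+m/n≤2*[m/n] : suc (m / n) ≤ 2 * (m / n)
  1+m/n≤2*[m/n] = ≤-trans (m<m*n (m / n) 2 (s≤s (s≤s z≤n))) (≤-reflexive (*-comm (m / n) 2))

^-distrib-* : ∀ m n o → (m * n) ^ o ≡ m ^ o * n ^ o
^-distrib-* m n zero    = refl
^-distrib-* m n (suc o) = begin
  m * n * (m * n) ^ o        ≡⟨ cong (m * n *_) (^-distrib-* m n o) ⟩
  m * n * (m ^ o * n ^ o)    ≡⟨ interchange *-commutativeSemigroup m n (m ^ o) (n ^ o) ⟩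
  m * m ^ o * (n * n ^ o)    ∎
  where open ≡-Reasoning

2*[1+n]∸1≡[1+n]+n : ∀ n → 2 * suc n ∸ 1 ≡ suc n + n
2*[1+n]∸1≡[1+n]+n n = trans (cong (n +_) (+-identityʳ (suc n))) (+-suc n n)

^-≤-of-log-ratio : ∀ {K Δ a b} L .{{_ : NonZero K}} → K ^ a < Δ ^ b → L * b ≤ a → K ^ L ≤ Δ
^-≤-of-log-ratio {K} {Δ} {a} {b} L K^a<Δ^b Lb≤a = ≮⇒≥ λ Δ<K^L → <⇒≱ K^a<Δ^b (begin
  Δ ^ b        ≤⟨ ^-monoˡ-≤ b (<⇒≤ Δ<K^L) ⟩
  (K ^ L) ^ b  ≡⟨ ^-*-assoc K L b ⟩
  K ^ (L * b)  ≤⟨ ^-monoʳ-≤ K Lb≤a ⟩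
  K ^ a        ∎)
  where open ≤-Reasoning

blocks*width^[1+n]≤Δ : ∀ n {kB Δ a b L g} → L * g ≤ 2 * kB → a ≤ 2 * L * b →
  2 ^ (2 * suc n ∸ 1) * kB ^ suc n * b ^ n < Δ * a ^ n → L * g ^ suc n ≤ Δ
blocks*width^[1+n]≤Δ n {kB} {Δ} {a} {b} {L} {g} Lg≤2kB a≤2Lb hyp =
  <⇒≤ (*-cancelˡ-< (L ^ n) _ _ (begin-strict
    L ^ n * (L * g ^ K)  ≡⟨ sym (*-assoc (L ^ n) L (g ^ K)) ⟩
    L ^ n * L * g ^ K    ≡⟨ cong (_* g ^ K) (*-comm (L ^ n) L) ⟩
    L ^ K * g ^ K        ≡⟨ sym (^-distrib-* L g K) ⟩
    (L * g) ^ K          ≤⟨ ^-monoˡ-≤ K Lg≤2kB ⟩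
    (2 * kB) ^ K         <⟨ [2kB]^K<Δ*L^n ⟩
    Δ * L ^ n            ≡⟨ *-comm Δ (L ^ n) ⟩
    L ^ n * Δ            ∎))
  where
  open ≤-Reasoning
  K = suc n
  [2kB]^K<Δ*L^n : (2 * kB) ^ K < Δ * L ^ n
  [2kB]^K<Δ*L^n = *-cancelʳ-< (2 ^ n * b ^ n) _ _ (begin-strict
    (2 * kB) ^ K * (2 ^ n * b ^ n)    ≡⟨ cong (_* (2 ^ n * b ^ n)) (^-distrib-* 2 kB K) ⟩
    2 ^ K * kB ^ K * (2 ^ n * b ^ n)  ≡⟨ interchange *-commutativeSemigroup (2 ^ K) (kB ^ K) (2 ^ n) (b ^ n) ⟩
    2 ^ K * 2 ^ n * (kB ^ K * b ^ n)  ≡⟨ cong (_* (kB ^ K * b ^ n)) (sym (^-distribˡ-+-* 2 K n)) ⟩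
    2 ^ (K + n) * (kB ^ K * b ^ n)    ≡⟨ cong (λ e → 2 ^ e * (kB ^ K * b ^ n)) (sym (2*[1+n]∸1≡[1+n]+n n)) ⟩
    2 ^ (2 * K ∸ 1) * (kB ^ K * b ^ n)  ≡⟨ sym (*-assoc (2 ^ (2 * K ∸ 1)) (kB ^ K) (b ^ n)) ⟩
    2 ^ (2 * K ∸ 1) * kB ^ K * b ^ n  <⟨ hyp ⟩
    Δ * a ^ n                         ≤⟨ *-monoʳ-≤ Δ (^-monoˡ-≤ n a≤2Lb) ⟩
    Δ * (2 * L * b) ^ n               ≡⟨ cong (Δ *_) (trans (^-distrib-* (2 * L) b n) (cong (_* b ^ n) (^-distrib-* 2 L n))) ⟩
    Δ * (2 ^ n * L ^ n * b ^ n)       ≡⟨ regroup Δ (2 ^ n) (L ^ n) (b ^ n) ⟩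
    Δ * L ^ n * (2 ^ n * b ^ n)       ∎)
    where
    regroup : ∀ d t l c → d * (t * l * c) ≡ d * l * (t * c)
    regroup = solve-∀

record BlockParameters (kA kB ΔA ΔB : ℕ) : Set where
  field
    blocks width : ℕ
    blocks≢0 : NonZero blocks
    width≢0 : NonZero width
    kB≤blocks*width : kB ≤ blocks * width
    kA^blocks≤ΔA : kA ^ blocks ≤ ΔA
    blocks*width^kA≤ΔB : blocks * width ^ kA ≤ ΔB

BlockParameters⇒¬Choosable : ∀ {kA kB ΔA ΔB} .{{_ : NonZero kA}} →
  BlockParameters kA kB ΔA ΔB → ¬ Choosable ΔB ΔA (KEdge ΔB ΔA) kA kB
BlockParameters⇒¬Choosable {kA} p =
  Blocks.¬Choosable kA blocks width
  ∘ Choosable-K-antimono {{m*n≢0 blocks (width ^ kA) {{blocks≢0}} {{m^n≢0 width kA {{width≢0}}}}}}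
                         {{m^n≢0 kA blocks}}
                         blocks*width^kA≤ΔB kA^blocks≤ΔA
  ∘ Choosable-mono-kB kB≤blocks*width
  where open BlockParameters p

balancedBlocks : ∀ n {kB ΔA ΔB a b} L {{_ : NonZero L}} → L ≤ kB → suc n ^ L ≤ ΔA → a ≤ 2 * L * b →
  2 ^ (2 * suc n ∸ 1) * kB ^ suc n * b ^ n < ΔB * a ^ n → BlockParameters (suc n) kB ΔA ΔB
balancedBlocks n {kB} L {{L≢0}} L≤kB K^L≤ΔA a≤2Lb hyp = record
  { blocks = L
  ; width = suc (kB / L)
  ; blocks≢0 = L≢0
  ; width≢0 = _
  ; kB≤blocks*width = ≤-trans (<⇒≤ (m<[1+m/n]*n kB L)) (≤-reflexive (*-comm (suc (kB / L)) L))
  ; kA^blocks≤ΔA = K^L≤ΔA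
  ; blocks*width^kA≤ΔB = blocks*width^[1+n]≤Δ n {kB} {L = L} {g = suc (kB / L)} L*width≤2kB a≤2Lb hyp
  }
  where
  L*width≤2kB : L * suc (kB / L) ≤ 2 * kB
  L*width≤2kB = begin
    L * suc (kB / L)    ≡⟨ *-suc L (kB / L) ⟩
    L + L * (kB / L)    ≡⟨ cong (L +_) (*-comm L (kB / L)) ⟩
    L + kB / L * L      ≤⟨ +-mono-≤ L≤kB (m/n*n≤m kB L) ⟩
    kB + kB             ≡⟨ cong (kB +_) (sym (+-identityʳ kB)) ⟩
    2 * kB              ∎
    where open ≤-Reasoning

LogCond⇒BlockParameters : ∀ kA kB ΔA ΔB {{_ : NonZero kB}} → 1 ≤ ΔA → kA ≤ ΔA → kB ≤ ΔB →
  LogCond kA kB ΔA ΔB → BlockParameters kA kB ΔA ΔB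
LogCond⇒BlockParameters 1 kB ΔA ΔB {{kB≢0}} 1≤ΔA _ kB≤ΔB _ = record
  { blocks = 1
  ; width = kB
  ; blocks≢0 = _
  ; width≢0 = kB≢0
  ; kB≤blocks*width = ≤-reflexive (sym (*-identityˡ kB))
  ; kA^blocks≤ΔA = 1≤ΔA
  ; blocks*width^kA≤ΔB = ≤-trans (≤-reflexive (trans (*-identityˡ (kB ^ 1)) (*-identityʳ kB))) kB≤ΔB
  }
LogCond⇒BlockParameters K@(suc (suc m)) kB ΔA ΔB {{kB≢0}} _ K≤ΔA kB≤ΔB (a , b , z<s , K^a<ΔA^b , hyp)
  with a <? b | kB ≤? a / b
... | yes a<b | _ = balancedBlocks (suc m) 1 (>-nonZero⁻¹ kB) (≤-trans (≤-reflexive (*-identityʳ K)) K≤ΔA)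
                                   (≤-trans (<⇒≤ a<b) (m≤m+n b _)) hyp
... | no a≮b | yes kB≤a/b = record
  { blocks = kB
  ; width = 1
  ; blocks≢0 = kB≢0
  ; width≢0 = _
  ; kB≤blocks*width = ≤-reflexive (sym (*-identityʳ kB))
  ; kA^blocks≤ΔA = ^-≤-of-log-ratio kB K^a<ΔA^b (≤-trans (*-monoˡ-≤ b kB≤a/b) (m/n*n≤m a b))
  ; blocks*width^kA≤ΔB = ≤-trans (≤-reflexive (trans (cong (kB *_) (^-zeroˡ K)) (*-identityʳ kB))) kB≤ΔB
  }
... | no a≮b | no kB≰a/b =
  balancedBlocks (suc m) (a / b) {{>-nonZero (m≥n⇒m/n>0 (≮⇒≥ a≮b))}} (<⇒≤ (≰⇒> kB≰a/b))
    (^-≤-of-log-ratio (a / b) K^a<ΔA^b (m/n*n≤m a b)) (m≤2*[m/n]*n a b (≮⇒≥ a≮b)) hyp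

proposition2p4 : (kA kB ΔA ΔB : ℕ) →
    1 ≤ kA → 1 ≤ kB → 1 ≤ ΔA → 1 ≤ ΔB →
    kA ≤ ΔA → kB ≤ ΔB →
    LogCond kA kB ΔA ΔB →
    ¬ Choosable ΔB ΔA (KEdge ΔB ΔA) kA kB
proposition2p4 kA@(suc _) kB@(suc _) ΔA ΔB _ _ 1≤ΔA _ kA≤ΔA kB≤ΔB cond =
  BlockParameters⇒¬Choosable (LogCond⇒BlockParameters kA kB ΔA ΔB 1≤ΔA kA≤ΔA kB≤ΔB cond)
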